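{- Let $n\ge 2$. If $Y\subseteq S_n$ is a nonempty $2$-design in $(S_n,d_S)$, then $|Y|\ge (n-1)^2+1$.
   Context: $S_n$ is the symmetric group on $n$ letters. For $\nu\in S_n$ let $F(\nu)$ be its number of fixed points; the metric is $d_S(\sigma,\theta)=n-F(\sigma\theta^{ -1})$. For $j\in\{0,\dots,n\}$ let $v_j$ be the number of permutations with exactly $n-j$ fixed points. For nonempty $D\subseteq S_n$, its frequencies are $f_i=|\{(x,y)\in D^2: d_S(x,y)=i\}|/|D|^2$, $i=0,\dots,n$. $D$ is a $t$-design if $\sum_{j=0}^n f_j j^i=\sum_{j=0}^n \frac{v_j}{n!} j^i$ for every $i=1,\dots,t$. -}

module Defs where

open import Data.Nat using (ℕ; zero; suc; _+_; _*_; _∸_; _^_; _≤_)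
open import Data.Nat using (_!)
open import Data.Nat.ListAction using (sum)
open import Data.Fin using (Fin; _≟_)
open import Data.Fin.Properties using (any?; all?)
open import Data.Vec using (Vec; []; _∷_; lookup; tabulate)
import Data.Nat as ℕ
open import Data.List using (List; []; _∷_; [_]; length; map; concatMap; filter; upTo; allFin; cartesianProduct)
open import Data.Product using (_×_; _,_; proj₁; proj₂)
open import Relation.Nullary using (Dec; yes; no)
open import Relation.Nullary.Decidable using (_→-dec_)
open import Relation.Binary.PropositionalEquality using (_≡_)

RawMap : ℕ → Set
RawMap n = Vec (Fin n) n

IsPerm : ∀ {n} → RawMap n → Set
IsPerm σ = ∀ i j → lookup σ i ≡ lookup σ j → i ≡ j

isPerm? : ∀ {n} (σ : RawMap n) → Dec (IsPerm σ)
isPerm? σ = all? (λ i → all? (λ j → (lookup σ i ≟ lookup σ j) →-dec (i ≟ j)))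

allVecs : ∀ {n} k → List (Vec (Fin n) k)
allVecs zero = [ [] ]
allVecs {n} (suc k) = concatMap (λ x → map (x ∷_) (allVecs k)) (allFin n)

Sym : ∀ n → List (RawMap n)
Sym n = filter isPerm? (allVecs n)

_∘ₚ_ : ∀ {n} → RawMap n → RawMap n → RawMap n
σ ∘ₚ τ = tabulate (λ i → lookup σ (lookup τ i))

inv : ∀ {n} → RawMap n → RawMap n
inv θ = tabulate (λ i → pick i (any? (λ j → lookup θ j ≟ i)))
  where
  pick : ∀ {n} {P : Fin n → Set} → Fin n → Dec (Data.Product.∃ P) → Fin n
  pick i (yes (j , _)) = j
  pick i (no _) = i

F : ∀ {n} → RawMap n → ℕ
F {n} ν = length (filter (λ i → lookup ν i ≟ i) (allFin n))

dS : ∀ {n} → RawMap n → RawMap n → ℕ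
dS {n} σ θ = n ∸ F (σ ∘ₚ inv θ)

v : ∀ n → ℕ → ℕ
v n j = length (filter (λ σ → F σ ℕ.≟ (n ∸ j)) (Sym n))

-- N_j = |{(x,y) ∈ D² : d_S(x,y) = j}|, so that f_j = N_j / |D|²
pairCount : ∀ {n} → List (RawMap n) → ℕ → ℕ
pairCount D j = length (filter (λ p → dS (proj₁ p) (proj₂ p) ℕ.≟ j) (cartesianProduct D D))

Σ≤ : ℕ → (ℕ → ℕ) → ℕ
Σ≤ n g = sum (map g (upTo (suc n)))

-- t-design condition, with denominators |D|² and n! cleared:
--   Σ_j f_j j^i = Σ_j (v_j / n!) j^i
--   ⇔ n! · Σ_j N_j j^i = |D|² · Σ_j v_j j^i      (for each 1 ≤ i ≤ t)
IsDesign : ∀ n → ℕ → List (RawMap n) → Set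
IsDesign n t D = ∀ i → 1 ≤ i → i ≤ t →
  (n !) * Σ≤ n (λ j → pairCount D j * j ^ i)
    ≡ (length D ^ 2) * Σ≤ n (λ j → v n j * j ^ i)

{-# OPTIONS --safe #-}
-- For a permutation ν let F₂ ν be the number of ordered pairs of distinct fixed points of ν.
-- As F₂ = F (F − 1) and the distance of ν from the identity is d = n − F, F₂ is a quadratic
-- polynomial in d, so the first two moments of the distance distribution determine the
-- average of F₂. Over S_n this average is 1 (every ordered pair of distinct points is fixed
-- by equally many permutations), so for a 2-design Y the sum of F₂ (x y⁻¹) over (x , y) ∈ Y²
-- is |Y|². The diagonal pairs alone contribute |Y| (n² − n), hence
-- |Y| ≥ n² − n ≥ (n − 1)² + 1.
module Submission where

open import Defs
open import Data.Bool.Base using (true; false; if_then_else_)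
open import Data.Empty using (⊥; ⊥-elim)
open import Data.Fin using (Fin; zero; suc)
import Data.Fin as Fin
open import Data.Fin.Permutation using (Permutation; _⟨$⟩ʳ_; _⟨$⟩ˡ_; inverseˡ; transpose)
open import Data.Fin.Properties using (any?; all?; injective⇒≤; punchOut-injective; suc-injective; 0≢1+n)
open import Data.List using (List; []; _∷_; _++_; map; concatMap; filter; length; allFin; upTo; cartesianProduct)
open import Data.List.Membership.Propositional using (_∈_)
open import Data.List.Membership.Propositional.Properties using (∈-filter⁻; ∈-upTo⁻)
open import Data.List.Properties
  using (map-++; map-cong; map-cong-local; map-∘; map-tabulate; map-applyUpTo; length-filter; length-tabulate; length-++; length-map)
open import Data.List.Relation.Unary.All using (All)
import Data.List.Relation.Unary.All as All
open import Data.List.Relation.Unary.Any using (here; there)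
open import Data.List.Relation.Unary.Unique.Propositional using (Unique)
open import Data.Nat using (ℕ; zero; suc; _+_; _*_; _∸_; _^_; _≤_; _<_; z≤n; s≤s; NonZero; _!)
import Data.Nat as ℕ
open import Data.Nat.Combinatorics.Base using (_P′_)
open import Data.Nat.Combinatorics.Specification using (nP′n≡n!)
open import Data.Nat.ListAction using (sum)
open import Data.Nat.ListAction.Properties using (sum-++)
open import Data.Nat.Properties hiding (suc-injective; 0≢1+n)
open import Algebra.Properties.CommutativeSemigroup +-commutativeSemigroup using (interchange)
import Algebra.Properties.CommutativeMonoid.Sum +-0-commutativeMonoid as Vec∑
open import Data.Nat.Tactic.RingSolver using (solve-∀)
open import Data.Product using (_×_; _,_; proj₂; ∃)
open import Data.Sum using (_⊎_; inj₁; inj₂; [_,_]′)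
open import Data.Vec using (Vec; []; _∷_; lookup)
import Data.Vec as V
open import Data.Vec.Properties using (lookup∘tabulate; lookup-map)
open import Function using (_∘_; id; _∋_)
open import Relation.Binary.PropositionalEquality
open import Relation.Nullary using (Dec; yes; no; does; ¬_; ¬?)
open import Relation.Nullary.Decidable using (_×-dec_; _→-dec_)

private variable
  A B : Set
  P Q R : Set

-- Indicators and finite sums

𝟙 : Dec P → ℕ
𝟙 d = if does d then 1 else 0

𝟙-cong : (P → Q) → (Q → P) → (d : Dec P) (e : Dec Q) → 𝟙 d ≡ 𝟙 e
𝟙-cong to from (yes _) (yes _) = refl
𝟙-cong to from (yes p) (no ¬q) = ⊥-elim (¬q (to p))
𝟙-cong to from (no ¬p) (yes q) = ⊥-elim (¬p (from q))
𝟙-cong to from (no _)  (no _)  = refl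

𝟙-¬?+𝟙 : (d : Dec P) → 𝟙 (¬? d) + 𝟙 d ≡ 1
𝟙-¬?+𝟙 (yes _) = refl
𝟙-¬?+𝟙 (no _)  = refl

𝟙-idem : (d : Dec P) → 𝟙 d * 𝟙 d ≡ 𝟙 d
𝟙-idem (yes _) = refl
𝟙-idem (no _)  = refl

𝟙-×-dec : (d : Dec P) (e : Dec Q) → 𝟙 (d ×-dec e) ≡ 𝟙 d * 𝟙 e
𝟙-×-dec (yes _) (yes _) = refl
𝟙-×-dec (yes _) (no _)  = refl
𝟙-×-dec (no _)  _       = refl

𝟙-⊎ : (P → Q ⊎ R) → (Q ⊎ R → P) → (Q → R → ⊥) →
      (d : Dec P) (e : Dec Q) (f : Dec R) → 𝟙 d ≡ 𝟙 e + 𝟙 f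
𝟙-⊎ to from disj (yes _) (yes q) (yes r) = ⊥-elim (disj q r)
𝟙-⊎ to from disj (yes _) (yes _) (no _)  = refl
𝟙-⊎ to from disj (yes _) (no _)  (yes _) = refl
𝟙-⊎ to from disj (yes p) (no ¬q) (no ¬r) = ⊥-elim ([ ¬q , ¬r ]′ (to p))
𝟙-⊎ to from disj (no ¬p) (yes q) _       = ⊥-elim (¬p (from (inj₁ q)))
𝟙-⊎ to from disj (no ¬p) (no _)  (yes r) = ⊥-elim (¬p (from (inj₂ r)))
𝟙-⊎ to from disj (no _)  (no _)  (no _)  = refl

∑ : List A → (A → ℕ) → ℕ
∑ xs f = sum (map f xs)

module _ {f g : A → ℕ} where

  ∑-cong : ∀ xs → (∀ x → f x ≡ g x) → ∑ xs f ≡ ∑ xs g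
  ∑-cong xs eq = cong sum (map-cong eq xs)

  ∑-cong-∈ : ∀ xs → (∀ {x} → x ∈ xs → f x ≡ g x) → ∑ xs f ≡ ∑ xs g
  ∑-cong-∈ xs eq = cong sum (map-cong-local (All.tabulate eq))

  ∑-mono-≤ : ∀ xs → (∀ {x} → x ∈ xs → f x ≤ g x) → ∑ xs f ≤ ∑ xs g
  ∑-mono-≤ []       le = z≤n
  ∑-mono-≤ (x ∷ xs) le = +-mono-≤ (le (here refl)) (∑-mono-≤ xs (le ∘ there))

  ∑-distrib-+ : ∀ xs → ∑ xs (λ x → f x + g x) ≡ ∑ xs f + ∑ xs g
  ∑-distrib-+ []       = refl
  ∑-distrib-+ (x ∷ xs) = begin
    f x + g x + ∑ xs (λ x → f x + g x) ≡⟨ cong (f x + g x +_) (∑-distrib-+ xs) ⟩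
    f x + g x + (∑ xs f + ∑ xs g)      ≡⟨ interchange (f x) (g x) _ _ ⟩
    f x + ∑ xs f + (g x + ∑ xs g)      ∎
    where open ≡-Reasoning

∑-++ : ∀ xs ys (f : A → ℕ) → ∑ (xs ++ ys) f ≡ ∑ xs f + ∑ ys f
∑-++ xs ys f = trans (cong sum (map-++ f xs ys)) (sum-++ (map f xs) (map f ys))

*-distribˡ-∑ : ∀ c xs (f : A → ℕ) → c * ∑ xs f ≡ ∑ xs (λ x → c * f x)
*-distribˡ-∑ c []       f = *-zeroʳ c
*-distribˡ-∑ c (x ∷ xs) f = trans (*-distribˡ-+ c (f x) _) (cong (c * f x +_) (*-distribˡ-∑ c xs f))

∑-const : ∀ (xs : List A) c → ∑ xs (λ _ → c) ≡ length xs * c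
∑-const []       c = refl
∑-const (x ∷ xs) c = cong (c +_) (∑-const xs c)

∑-zero : ∀ (xs : List A) → ∑ xs (λ _ → 0) ≡ 0
∑-zero xs = trans (∑-const xs 0) (*-zeroʳ (length xs))

∑-map : ∀ (h : B → A) xs (f : A → ℕ) → ∑ (map h xs) f ≡ ∑ xs (f ∘ h)
∑-map h xs f = cong sum (sym (map-∘ xs))

∑-concatMap : ∀ (h : B → List A) xs (f : A → ℕ) → ∑ (concatMap h xs) f ≡ ∑ xs (λ y → ∑ (h y) f)
∑-concatMap h []       f = refl
∑-concatMap h (y ∷ ys) f = trans (∑-++ (h y) (concatMap h ys) f) (cong (∑ (h y) f +_) (∑-concatMap h ys f))

∑-cartesianProduct : ∀ (xs : List A) (ys : List B) f →
                     ∑ (cartesianProduct xs ys) f ≡ ∑ xs (λ x → ∑ ys (λ y → f (x , y)))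
∑-cartesianProduct []       ys f = refl
∑-cartesianProduct (x ∷ xs) ys f =
  trans (∑-++ (map (x ,_) ys) (cartesianProduct xs ys) f)
        (cong₂ _+_ (∑-map (x ,_) ys f) (∑-cartesianProduct xs ys f))

∑-filter : {P : A → Set} (P? : ∀ x → Dec (P x)) → ∀ xs (f : A → ℕ) →
           ∑ (filter P? xs) f ≡ ∑ xs (λ x → 𝟙 (P? x) * f x)
∑-filter P? []       f = refl
∑-filter P? (x ∷ xs) f with does (P? x)
... | true  = cong₂ _+_ (sym (+-identityʳ (f x))) (∑-filter P? xs f)
... | false = ∑-filter P? xs f

length-filter≡∑𝟙 : {P : A → Set} (P? : ∀ x → Dec (P x)) → ∀ xs →
                   length (filter P? xs) ≡ ∑ xs (𝟙 ∘ P?)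
length-filter≡∑𝟙 P? xs = begin
  length (filter P? xs)            ≡⟨ sym (*-identityʳ _) ⟩
  length (filter P? xs) * 1        ≡⟨ sym (∑-const (filter P? xs) 1) ⟩
  ∑ (filter P? xs) (λ _ → 1)       ≡⟨ ∑-filter P? xs (λ _ → 1) ⟩
  ∑ xs (λ x → 𝟙 (P? x) * 1)        ≡⟨ ∑-cong xs (λ x → *-identityʳ (𝟙 (P? x))) ⟩
  ∑ xs (𝟙 ∘ P?)                    ∎
  where open ≡-Reasoning

∑-comm : ∀ (xs : List A) (ys : List B) (f : A → B → ℕ) →
         ∑ xs (λ x → ∑ ys (f x)) ≡ ∑ ys (λ y → ∑ xs (λ x → f x y))
∑-comm []       ys f = sym (∑-zero ys)
∑-comm (x ∷ xs) ys f = trans (cong (∑ ys (f x) +_) (∑-comm xs ys f)) (sym (∑-distrib-+ ys))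

∈⇒≤∑ : ∀ {x} {xs : List A} (f : A → ℕ) → x ∈ xs → f x ≤ ∑ xs f
∈⇒≤∑ {xs = y ∷ xs} f (here refl) = m≤m+n (f y) _
∈⇒≤∑ {xs = y ∷ xs} f (there x∈) = ≤-trans (∈⇒≤∑ f x∈) (m≤n+m _ (f y))

∑-allFin-suc : ∀ n (f : Fin (suc n) → ℕ) → ∑ (allFin (suc n)) f ≡ f zero + ∑ (allFin n) (f ∘ suc)
∑-allFin-suc n f = cong (λ xs → f zero + sum xs) (trans (map-tabulate suc f) (sym (map-tabulate id (f ∘ suc))))

∑-allFin≡sum : ∀ n (f : Fin n → ℕ) → ∑ (allFin n) f ≡ Vec∑.sum f
∑-allFin≡sum zero    f = refl
∑-allFin≡sum (suc n) f = trans (∑-allFin-suc n f) (cong (f zero +_) (∑-allFin≡sum n (f ∘ suc)))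

∑-allFin-permute : ∀ {n} (π : Permutation n n) (f : Fin n → ℕ) →
                   ∑ (allFin n) (f ∘ (π ⟨$⟩ʳ_)) ≡ ∑ (allFin n) f
∑-allFin-permute {n} π f = begin
  ∑ (allFin n) (f ∘ (π ⟨$⟩ʳ_)) ≡⟨ ∑-allFin≡sum n _ ⟩
  Vec∑.sum (f ∘ (π ⟨$⟩ʳ_))     ≡⟨ sym (Vec∑.sum-permute f π) ⟩
  Vec∑.sum f                   ≡⟨ sym (∑-allFin≡sum n f) ⟩
  ∑ (allFin n) f               ∎
  where open ≡-Reasoning

∑-allFin-δ : ∀ {n} (a : Fin n) (f : Fin n → ℕ) → ∑ (allFin n) (λ k → 𝟙 (a Fin.≟ k) * f k) ≡ f a
∑-allFin-δ {suc n} zero f = begin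
  ∑ (allFin (suc n)) (λ k → 𝟙 (zero Fin.≟ k) * f k) ≡⟨ ∑-allFin-suc n _ ⟩
  f zero + 0 + ∑ (allFin n) (λ _ → 0)               ≡⟨ cong₂ _+_ (+-identityʳ (f zero)) (∑-zero (allFin n)) ⟩
  f zero + 0                                         ≡⟨ +-identityʳ (f zero) ⟩
  f zero                                             ∎
  where open ≡-Reasoning
∑-allFin-δ {suc n} (suc a) f = trans (∑-allFin-suc n (λ k → 𝟙 (suc a Fin.≟ k) * f k)) (∑-allFin-δ a (f ∘ suc))

∑-allFin-const : ∀ n c → ∑ (allFin n) (λ _ → c) ≡ n * c
∑-allFin-const n c = trans (∑-const (allFin n) c) (cong (_* c) (length-tabulate {n = n} id))

∑-upTo-suc : ∀ m (f : ℕ → ℕ) → ∑ (upTo (suc m)) f ≡ f 0 + ∑ (upTo m) (f ∘ suc)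
∑-upTo-suc m f = cong (λ xs → f 0 + sum xs) (trans (map-applyUpTo suc f m) (sym (map-applyUpTo id (f ∘ suc) m)))

∑-upTo-δ : ∀ {m a} (g : ℕ → ℕ) → a < m → ∑ (upTo m) (λ j → 𝟙 (a ℕ.≟ j) * g j) ≡ g a
∑-upTo-δ {suc m} {zero}  g _ = begin
  ∑ (upTo (suc m)) (λ j → 𝟙 (0 ℕ.≟ j) * g j) ≡⟨ ∑-upTo-suc m _ ⟩
  g 0 + 0 + ∑ (upTo m) (λ _ → 0)             ≡⟨ cong₂ _+_ (+-identityʳ (g 0)) (∑-zero (upTo m)) ⟩
  g 0 + 0                                     ≡⟨ +-identityʳ (g 0) ⟩
  g 0                                         ∎
  where open ≡-Reasoning
∑-upTo-δ {suc m} {suc a} g (s≤s a<m) = trans (∑-upTo-suc m (λ j → 𝟙 (suc a ℕ.≟ j) * g j)) (∑-upTo-δ (g ∘ suc) a<m)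

-- Fixed points

fixed? : ∀ {n} (ν : RawMap n) (i : Fin n) → Dec (lookup ν i ≡ i)
fixed? ν i = lookup ν i Fin.≟ i

F≡∑ : ∀ {n} (ν : RawMap n) → F ν ≡ ∑ (allFin n) (𝟙 ∘ fixed? ν)
F≡∑ {n} ν = length-filter≡∑𝟙 (fixed? ν) (allFin n)

F≤n : ∀ {n} (ν : RawMap n) → F ν ≤ n
F≤n {n} ν = ≤-trans (length-filter (fixed? ν) (allFin n)) (≤-reflexive (length-tabulate {n = n} id))

moved : ∀ {n} → RawMap n → ℕ
moved {n} ν = n ∸ F ν

F₂ : ∀ {n} → RawMap n → ℕ
F₂ {n} ν = ∑ (allFin n) λ i → ∑ (allFin n) λ k → 𝟙 (¬? (i Fin.≟ k)) * (𝟙 (fixed? ν i) * 𝟙 (fixed? ν k))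

∑-split-diagonal : ∀ {n} (i : Fin n) (g : Fin n → ℕ) →
                   ∑ (allFin n) g ≡ ∑ (allFin n) (λ k → 𝟙 (¬? (i Fin.≟ k)) * g k) + g i
∑-split-diagonal {n} i g = begin
  ∑ (allFin n) g
    ≡⟨ ∑-cong (allFin n) (λ k → sym (trans (cong (_* g k) (𝟙-¬?+𝟙 (i Fin.≟ k))) (+-identityʳ (g k)))) ⟩
  ∑ (allFin n) (λ k → (𝟙 (¬? (i Fin.≟ k)) + 𝟙 (i Fin.≟ k)) * g k)
    ≡⟨ ∑-cong (allFin n) (λ k → *-distribʳ-+ (g k) (𝟙 (¬? (i Fin.≟ k))) _) ⟩
  ∑ (allFin n) (λ k → 𝟙 (¬? (i Fin.≟ k)) * g k + 𝟙 (i Fin.≟ k) * g k)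
    ≡⟨ ∑-distrib-+ (allFin n) ⟩
  ∑ (allFin n) (λ k → 𝟙 (¬? (i Fin.≟ k)) * g k) + ∑ (allFin n) (λ k → 𝟙 (i Fin.≟ k) * g k)
    ≡⟨ cong (∑ (allFin n) (λ k → 𝟙 (¬? (i Fin.≟ k)) * g k) +_) (∑-allFin-δ i g) ⟩
  ∑ (allFin n) (λ k → 𝟙 (¬? (i Fin.≟ k)) * g k) + g i
    ∎
  where open ≡-Reasoning

F*F≡F₂+F : ∀ {n} (ν : RawMap n) → F ν * F ν ≡ F₂ ν + F ν
F*F≡F₂+F {n} ν = begin
  F ν * F ν                                 ≡⟨ cong (F ν *_) (F≡∑ ν) ⟩
  F ν * ∑ (allFin n) a                      ≡⟨ *-distribˡ-∑ (F ν) (allFin n) a ⟩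
  ∑ (allFin n) (λ i → F ν * a i)            ≡⟨ ∑-cong (allFin n) row ⟩
  ∑ (allFin n) (λ i → offDiagonal i + a i)  ≡⟨ ∑-distrib-+ (allFin n) ⟩
  F₂ ν + ∑ (allFin n) a                     ≡⟨ cong (F₂ ν +_) (F≡∑ ν) ⟨
  F₂ ν + F ν                                ∎
  where
  open ≡-Reasoning
  a : Fin n → ℕ
  a = 𝟙 ∘ fixed? ν
  offDiagonal : Fin n → ℕ
  offDiagonal i = ∑ (allFin n) (λ k → 𝟙 (¬? (i Fin.≟ k)) * (a i * a k))
  row : ∀ i → F ν * a i ≡ offDiagonal i + a i
  row i = begin
    F ν * a i                            ≡⟨ *-comm (F ν) (a i) ⟩
    a i * F ν                            ≡⟨ cong (a i *_) (F≡∑ ν) ⟩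
    a i * ∑ (allFin n) a                 ≡⟨ *-distribˡ-∑ (a i) (allFin n) a ⟩
    ∑ (allFin n) (λ k → a i * a k)       ≡⟨ ∑-split-diagonal i (λ k → a i * a k) ⟩
    offDiagonal i + a i * a i            ≡⟨ cong (offDiagonal i +_) (𝟙-idem (fixed? ν i)) ⟩
    offDiagonal i + a i                  ∎

quadratic-in-complement : ∀ g f j → f * f ≡ g + f →
                          g + (f + j) + 2 * (f + j) * j ^ 1 ≡ (f + j) * (f + j) + j ^ 2 + j ^ 1
quadratic-in-complement g f j ff = +-cancelʳ-≡ f _ _ (begin
  g + (f + j) + 2 * (f + j) * j ^ 1 + f       ≡⟨ regroupˡ g f j ⟩
  (g + f) + (f + j + 2 * (f + j) * j ^ 1)     ≡⟨ cong (_+ (f + j + 2 * (f + j) * j ^ 1)) ff ⟨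
  f * f + (f + j + 2 * (f + j) * j ^ 1)       ≡⟨ regroupʳ f j ⟩
  (f + j) * (f + j) + j ^ 2 + j ^ 1 + f       ∎)
  where
  open ≡-Reasoning
  regroupˡ : ∀ g f j → g + (f + j) + 2 * (f + j) * (j * 1) + f ≡ (g + f) + (f + j + 2 * (f + j) * (j * 1))
  regroupˡ = solve-∀
  regroupʳ : ∀ f j → f * f + (f + j + 2 * (f + j) * (j * 1)) ≡ (f + j) * (f + j) + j * (j * 1) + j * 1 + f
  regroupʳ = solve-∀

F₂-quadratic-in-moved : ∀ {n} (ν : RawMap n) → F₂ ν + n + 2 * n * moved ν ^ 1 ≡ n * n + moved ν ^ 2 + moved ν ^ 1
F₂-quadratic-in-moved {n} ν =
  subst (λ m → F₂ ν + m + 2 * m * moved ν ^ 1 ≡ m * m + moved ν ^ 2 + moved ν ^ 1)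
        (m+[n∸m]≡n (F≤n ν))
        (quadratic-in-complement (F₂ ν) (F ν) (moved ν) (F*F≡F₂+F ν))

IsPerm⇒surjective : ∀ {n} (σ : RawMap n) → IsPerm σ → ∀ i → ∃ λ j → lookup σ j ≡ i
-- If i is missed, punching it out squeezes Fin (suc n) injectively into Fin n.
IsPerm⇒surjective {suc n} σ σ-inj i with any? (λ j → lookup σ j Fin.≟ i)
... | yes hit = hit
... | no miss = ⊥-elim (<-irrefl refl (injective⇒≤ {f = squeeze} squeeze-injective))
  where
  i≢σ : ∀ j → i ≢ lookup σ j
  i≢σ j i≡σj = miss (j , sym i≡σj)
  squeeze : Fin (suc n) → Fin n
  squeeze j = Fin.punchOut (i≢σ j)
  squeeze-injective : ∀ {x y} → squeeze x ≡ squeeze y → x ≡ y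
  squeeze-injective {x} {y} = σ-inj x y ∘ punchOut-injective (i≢σ x) (i≢σ y)

lookup-inv : ∀ {n} (σ : RawMap n) i → (∃ λ j → lookup σ j ≡ i) → lookup σ (lookup (inv σ) i) ≡ i
lookup-inv σ i hit with any? (λ j → lookup σ j Fin.≟ i) | lookup (inv σ) i
                      | (lookup (inv σ) i ≡ _ ∋ lookup∘tabulate _ i)
... | yes (j , σj≡i) | _ | eq = trans (cong (lookup σ) eq) σj≡i
... | no miss        | _ | _  = ⊥-elim (miss hit)

F-∘ₚ-inv : ∀ {n} (σ : RawMap n) → IsPerm σ → F (σ ∘ₚ inv σ) ≡ n
F-∘ₚ-inv {n} σ σ-perm = begin
  F (σ ∘ₚ inv σ)                                ≡⟨ F≡∑ (σ ∘ₚ inv σ) ⟩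
  ∑ (allFin n) (𝟙 ∘ fixed? (σ ∘ₚ inv σ))        ≡⟨ ∑-cong (allFin n) all-fixed ⟩
  ∑ (allFin n) (λ _ → 1)                         ≡⟨ ∑-allFin-const n 1 ⟩
  n * 1                                          ≡⟨ *-identityʳ n ⟩
  n                                              ∎
  where
  open ≡-Reasoning
  all-fixed : ∀ i → 𝟙 (fixed? (σ ∘ₚ inv σ) i) ≡ 1
  all-fixed i with fixed? (σ ∘ₚ inv σ) i
  ... | yes _ = refl
  ... | no not-fixed = ⊥-elim (not-fixed (trans (lookup∘tabulate _ i)
                                                (lookup-inv σ i (IsPerm⇒surjective σ σ-perm i))))

F₂-∘ₚ-inv : ∀ {n} (σ : RawMap n) → IsPerm σ → F₂ (σ ∘ₚ inv σ) + n ≡ n * n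
F₂-∘ₚ-inv {n} σ σ-perm = begin
  F₂ (σ ∘ₚ inv σ) + n                ≡⟨ cong (F₂ (σ ∘ₚ inv σ) +_) (F-∘ₚ-inv σ σ-perm) ⟨
  F₂ (σ ∘ₚ inv σ) + F (σ ∘ₚ inv σ)   ≡⟨ F*F≡F₂+F (σ ∘ₚ inv σ) ⟨
  F (σ ∘ₚ inv σ) * F (σ ∘ₚ inv σ)    ≡⟨ cong₂ _*_ (F-∘ₚ-inv σ σ-perm) (F-∘ₚ-inv σ σ-perm) ⟩
  n * n                              ∎
  where open ≡-Reasoning

-- Sums over S_n

∑-allVecs-suc : ∀ {n} k (h : Vec (Fin n) (suc k) → ℕ) →
                ∑ (allVecs (suc k)) h ≡ ∑ (allFin n) (λ x → ∑ (allVecs k) (λ r → h (x ∷ r)))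
∑-allVecs-suc {n} k h = trans (∑-concatMap (λ x → map (x ∷_) (allVecs k)) (allFin n) h)
                              (∑-cong (allFin n) (λ x → ∑-map (x ∷_) (allVecs k) h))

∑-Sym≡∑-allVecs : ∀ n (h : RawMap n → ℕ) → ∑ (Sym n) h ≡ ∑ (allVecs n) (λ σ → 𝟙 (isPerm? σ) * h σ)
∑-Sym≡∑-allVecs n = ∑-filter isPerm? (allVecs n)

module _ {n : ℕ} (π : Permutation n n) where

  relabel : ∀ {k} → Vec (Fin n) k → Vec (Fin n) k
  relabel = V.map (π ⟨$⟩ʳ_)

  lookup-relabel : ∀ {k} (v : Vec (Fin n) k) i → lookup (relabel v) i ≡ π ⟨$⟩ʳ lookup v i
  lookup-relabel v i = lookup-map i (π ⟨$⟩ʳ_) v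

  π-injective : ∀ {a b} → π ⟨$⟩ʳ a ≡ π ⟨$⟩ʳ b → a ≡ b
  π-injective {a} {b} πa≡πb = trans (sym (inverseˡ π)) (trans (cong (π ⟨$⟩ˡ_) πa≡πb) (inverseˡ π))

  ∑-allVecs-relabel : ∀ k (h : Vec (Fin n) k → ℕ) → ∑ (allVecs k) (h ∘ relabel) ≡ ∑ (allVecs k) h
  ∑-allVecs-relabel zero    h = refl
  ∑-allVecs-relabel (suc k) h = begin
    ∑ (allVecs (suc k)) (h ∘ relabel)
      ≡⟨ ∑-allVecs-suc k (h ∘ relabel) ⟩
    ∑ (allFin n) (λ x → ∑ (allVecs k) (λ r → h ((π ⟨$⟩ʳ x) ∷ relabel r)))
      ≡⟨ ∑-cong (allFin n) (λ x → ∑-allVecs-relabel k (λ r → h ((π ⟨$⟩ʳ x) ∷ r))) ⟩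
    ∑ (allFin n) (λ x → ∑ (allVecs k) (λ r → h ((π ⟨$⟩ʳ x) ∷ r)))
      ≡⟨ ∑-allFin-permute π (λ x → ∑ (allVecs k) (λ r → h (x ∷ r))) ⟩
    ∑ (allFin n) (λ x → ∑ (allVecs k) (λ r → h (x ∷ r)))
      ≡⟨ ∑-allVecs-suc k h ⟨
    ∑ (allVecs (suc k)) h
      ∎
    where open ≡-Reasoning

  𝟙-relabel : ∀ {k} (v : Vec (Fin n) k) i a → 𝟙 (lookup (relabel v) i Fin.≟ π ⟨$⟩ʳ a) ≡ 𝟙 (lookup v i Fin.≟ a)
  𝟙-relabel v i a = 𝟙-cong (λ eq → π-injective (trans (sym (lookup-relabel v i)) eq))
                           (λ eq → trans (lookup-relabel v i) (cong (π ⟨$⟩ʳ_) eq))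
                           (lookup (relabel v) i Fin.≟ π ⟨$⟩ʳ a) (lookup v i Fin.≟ a)

  IsPerm-relabel⁺ : ∀ (σ : RawMap n) → IsPerm σ → IsPerm (relabel σ)
  IsPerm-relabel⁺ σ σ-inj i j eq =
    σ-inj i j (π-injective (trans (sym (lookup-relabel σ i)) (trans eq (lookup-relabel σ j))))

  IsPerm-relabel⁻ : ∀ (σ : RawMap n) → IsPerm (relabel σ) → IsPerm σ
  IsPerm-relabel⁻ σ πσ-inj i j eq =
    πσ-inj i j (trans (lookup-relabel σ i) (trans (cong (π ⟨$⟩ʳ_) eq) (sym (lookup-relabel σ j))))

  ∑-Sym-relabel : (h : RawMap n → ℕ) → ∑ (Sym n) (h ∘ relabel) ≡ ∑ (Sym n) h
  ∑-Sym-relabel h = begin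
    ∑ (Sym n) (h ∘ relabel)
      ≡⟨ ∑-Sym≡∑-allVecs n (h ∘ relabel) ⟩
    ∑ (allVecs n) (λ σ → 𝟙 (isPerm? σ) * h (relabel σ))
      ≡⟨ ∑-cong (allVecs n) (λ σ → cong (_* h (relabel σ)) (𝟙-cong (IsPerm-relabel⁺ σ) (IsPerm-relabel⁻ σ)
                                                                   (isPerm? σ) (isPerm? (relabel σ)))) ⟩
    ∑ (allVecs n) (λ σ → 𝟙 (isPerm? (relabel σ)) * h (relabel σ))
      ≡⟨ ∑-allVecs-relabel n (λ σ → 𝟙 (isPerm? σ) * h σ) ⟩
    ∑ (allVecs n) (λ σ → 𝟙 (isPerm? σ) * h σ)
      ≡⟨ ∑-Sym≡∑-allVecs n h ⟨
    ∑ (Sym n) h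
      ∎
    where open ≡-Reasoning

transpose-sends : ∀ {n} (x y : Fin n) → transpose x y ⟨$⟩ʳ x ≡ y
transpose-sends x y with x Fin.≟ x
... | yes _     = refl
... | no  x≢x   = ⊥-elim (x≢x refl)

transpose-fixes : ∀ {n} (x y z : Fin n) → z ≢ x → z ≢ y → transpose x y ⟨$⟩ʳ z ≡ z
transpose-fixes x y z z≢x z≢y with z Fin.≟ x
... | yes z≡x = ⊥-elim (z≢x z≡x)
... | no  _ with z Fin.≟ y
...   | yes z≡y = ⊥-elim (z≢y z≡y)
...   | no  _   = refl

#distinct-image-pairs≡1 : ∀ {n} (σ : RawMap n) {i k} → IsPerm σ → i ≢ k →
  ∑ (allFin n) (λ a → ∑ (allFin n) (λ b →
    𝟙 (¬? (a Fin.≟ b)) * (𝟙 (lookup σ i Fin.≟ a) * 𝟙 (lookup σ k Fin.≟ b)))) ≡ 1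
#distinct-image-pairs≡1 {n} σ {i} {k} σ-inj i≢k = begin
  ∑ (allFin n) (λ a → ∑ (allFin n) (λ b → distinct a b * (sends-i a * sends-k b)))
    ≡⟨ ∑-cong (allFin n) (λ a → ∑-cong (allFin n) (λ b → regroup (distinct a b) (sends-i a) (sends-k b))) ⟩
  ∑ (allFin n) (λ a → ∑ (allFin n) (λ b → sends-i a * (sends-k b * distinct a b)))
    ≡⟨ ∑-cong (allFin n) (λ a → *-distribˡ-∑ (sends-i a) (allFin n) (λ b → sends-k b * distinct a b)) ⟨
  ∑ (allFin n) (λ a → sends-i a * ∑ (allFin n) (λ b → sends-k b * distinct a b))
    ≡⟨ ∑-cong (allFin n) (λ a → cong (sends-i a *_) (∑-allFin-δ (lookup σ k) (distinct a))) ⟩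
  ∑ (allFin n) (λ a → sends-i a * distinct a (lookup σ k))
    ≡⟨ ∑-allFin-δ (lookup σ i) (λ a → distinct a (lookup σ k)) ⟩
  distinct (lookup σ i) (lookup σ k)
    ≡⟨ images-distinct ⟩
  1 ∎
  where
  open ≡-Reasoning
  distinct : Fin n → Fin n → ℕ
  distinct a b = 𝟙 (¬? (a Fin.≟ b))
  sends-i sends-k : Fin n → ℕ
  sends-i a = 𝟙 (lookup σ i Fin.≟ a)
  sends-k b = 𝟙 (lookup σ k Fin.≟ b)
  regroup : ∀ x y z → x * (y * z) ≡ y * (z * x)
  regroup x y z = trans (*-comm x (y * z)) (*-assoc y z x)
  images-distinct : distinct (lookup σ i) (lookup σ k) ≡ 1
  images-distinct with lookup σ i Fin.≟ lookup σ k
  ... | yes σi≡σk = ⊥-elim (i≢k (σ-inj i k σi≡σk))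
  ... | no  _     = refl

module _ {n : ℕ} (i k : Fin n) where

  #sending : Fin n → Fin n → ℕ
  #sending a b = ∑ (Sym n) (λ σ → 𝟙 (lookup σ i Fin.≟ a) * 𝟙 (lookup σ k Fin.≟ b))

  #sending-relabel : (π : Permutation n n) (a b : Fin n) → #sending (π ⟨$⟩ʳ a) (π ⟨$⟩ʳ b) ≡ #sending a b
  #sending-relabel π a b =
    trans (sym (∑-Sym-relabel π (λ σ → 𝟙 (lookup σ i Fin.≟ π ⟨$⟩ʳ a) * 𝟙 (lookup σ k Fin.≟ π ⟨$⟩ʳ b))))
          (∑-cong (Sym n) (λ σ → cong₂ _*_ (𝟙-relabel π σ i a) (𝟙-relabel π σ k b)))

  #sending-off-diagonal : ∀ {a b a′ b′} → a ≢ b → a′ ≢ b′ → #sending a b ≡ #sending a′ b′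
  #sending-off-diagonal {a} {b} {a′} {b′} a≢b a′≢b′ = begin
    #sending a b                         ≡⟨ #sending-relabel τ a b ⟨
    #sending (τ ⟨$⟩ʳ a) (τ ⟨$⟩ʳ b)       ≡⟨ cong (λ x → #sending x (τ ⟨$⟩ʳ b)) (transpose-sends a a′) ⟩
    #sending a′ (τ ⟨$⟩ʳ b)               ≡⟨ #sending-relabel τ′ a′ (τ ⟨$⟩ʳ b) ⟨
    #sending (τ′ ⟨$⟩ʳ a′) (τ′ ⟨$⟩ʳ (τ ⟨$⟩ʳ b))
      ≡⟨ cong₂ #sending (transpose-fixes (τ ⟨$⟩ʳ b) b′ a′ (τb≢a′ ∘ sym) a′≢b′)
                        (transpose-sends (τ ⟨$⟩ʳ b) b′) ⟩
    #sending a′ b′                       ∎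
    where
    open ≡-Reasoning
    τ = transpose a a′
    τb≢a′ : τ ⟨$⟩ʳ b ≢ a′
    τb≢a′ eq = a≢b (sym (π-injective τ (trans eq (sym (transpose-sends a a′)))))
    τ′ = transpose (τ ⟨$⟩ʳ b) b′

  ∑-#sending-off-diagonal : i ≢ k →
    ∑ (allFin n) (λ a → ∑ (allFin n) (λ b → 𝟙 (¬? (a Fin.≟ b)) * #sending a b)) ≡ length (Sym n)
  ∑-#sending-off-diagonal i≢k = begin
    ∑ (allFin n) (λ a → ∑ (allFin n) (λ b → 𝟙 (¬? (a Fin.≟ b)) * #sending a b))
      ≡⟨ ∑-cong (allFin n) (λ a → ∑-cong (allFin n) (λ b →
           *-distribˡ-∑ (𝟙 (¬? (a Fin.≟ b))) (Sym n) (sent-to a b))) ⟩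
    ∑ (allFin n) (λ a → ∑ (allFin n) (λ b → ∑ (Sym n) (term a b)))
      ≡⟨ ∑-cong (allFin n) (λ a → ∑-comm (allFin n) (Sym n) (term a)) ⟩
    ∑ (allFin n) (λ a → ∑ (Sym n) (λ σ → ∑ (allFin n) (λ b → term a b σ)))
      ≡⟨ ∑-comm (allFin n) (Sym n) _ ⟩
    ∑ (Sym n) (λ σ → ∑ (allFin n) (λ a → ∑ (allFin n) (λ b → term a b σ)))
      ≡⟨ ∑-cong-∈ (Sym n) (λ {σ} σ∈ →
           #distinct-image-pairs≡1 σ (proj₂ (∈-filter⁻ isPerm? {xs = allVecs n} σ∈)) i≢k) ⟩
    ∑ (Sym n) (λ _ → 1)
      ≡⟨ ∑-const (Sym n) 1 ⟩
    length (Sym n) * 1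
      ≡⟨ *-identityʳ _ ⟩
    length (Sym n)
      ∎
    where
    open ≡-Reasoning
    sent-to : Fin n → Fin n → RawMap n → ℕ
    sent-to a b σ = 𝟙 (lookup σ i Fin.≟ a) * 𝟙 (lookup σ k Fin.≟ b)
    term : Fin n → Fin n → RawMap n → ℕ
    term a b σ = 𝟙 (¬? (a Fin.≟ b)) * sent-to a b σ

#distinctPairs : ℕ → ℕ
#distinctPairs n = ∑ (allFin n) (λ a → ∑ (allFin n) (λ b → 𝟙 (¬? (a Fin.≟ b))))

#distinctPairs+n≡n*n : ∀ n → #distinctPairs n + n ≡ n * n
#distinctPairs+n≡n*n n = begin
  #distinctPairs n + n                                  ≡⟨ cong (#distinctPairs n +_) n≡∑1 ⟩
  #distinctPairs n + ∑ (allFin n) (λ _ → 1)             ≡⟨ ∑-distrib-+ (allFin n) ⟨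
  ∑ (allFin n) (λ a → ∑ (allFin n) (λ b → 𝟙 (¬? (a Fin.≟ b))) + 1)
    ≡⟨ ∑-cong (allFin n) (λ a → sym (trans (∑-split-diagonal a (λ _ → 1))
                                          (cong (_+ 1) (∑-cong (allFin n) (λ b → *-identityʳ _))))) ⟩
  ∑ (allFin n) (λ _ → ∑ (allFin n) (λ _ → 1))           ≡⟨ ∑-cong (allFin n) (λ _ → sym n≡∑1) ⟩
  ∑ (allFin n) (λ _ → n)                                ≡⟨ ∑-allFin-const n n ⟩
  n * n                                                 ∎
  where
  open ≡-Reasoning
  n≡∑1 : n ≡ ∑ (allFin n) (λ _ → 1)
  n≡∑1 = sym (trans (∑-allFin-const n 1) (*-identityʳ n))

#distinctPairs-nonZero : ∀ {n} → 2 ≤ n → NonZero (#distinctPairs n)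
#distinctPairs-nonZero {n@(suc _)} 2≤n = ℕ.≢-nonZero λ D≡0 →
  <-irrefl (trans (cong (_+ n) (sym D≡0)) (#distinctPairs+n≡n*n n)) (m<m*n n n 2≤n)

#distinctPairs*#sending : ∀ {n} (i k : Fin n) → i ≢ k → #distinctPairs n * #sending i k i k ≡ length (Sym n)
#distinctPairs*#sending {n} i k i≢k = begin
  #distinctPairs n * c
    ≡⟨ *-comm (#distinctPairs n) c ⟩
  c * #distinctPairs n
    ≡⟨ *-distribˡ-∑ c (allFin n) _ ⟩
  ∑ (allFin n) (λ a → c * ∑ (allFin n) (λ b → 𝟙 (¬? (a Fin.≟ b))))
    ≡⟨ ∑-cong (allFin n) (λ a → trans (*-distribˡ-∑ c (allFin n) _) (∑-cong (allFin n) (transport a))) ⟩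
  ∑ (allFin n) (λ a → ∑ (allFin n) (λ b → 𝟙 (¬? (a Fin.≟ b)) * #sending i k a b))
    ≡⟨ ∑-#sending-off-diagonal i k i≢k ⟩
  length (Sym n)
    ∎
  where
  open ≡-Reasoning
  c = #sending i k i k
  transport : ∀ a b → c * 𝟙 (¬? (a Fin.≟ b)) ≡ 𝟙 (¬? (a Fin.≟ b)) * #sending i k a b
  transport a b with a Fin.≟ b
  ... | yes _   = *-zeroʳ c
  ... | no  a≢b = trans (*-identityʳ c) (trans (#sending-off-diagonal i k i≢k a≢b) (sym (*-identityˡ _)))

∑-Sym-F₂ : ∀ n → 2 ≤ n → ∑ (Sym n) F₂ ≡ length (Sym n)
∑-Sym-F₂ n 2≤n = *-cancelˡ-≡ _ _ D {{#distinctPairs-nonZero 2≤n}} (begin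
  D * ∑ (Sym n) F₂
    ≡⟨ cong (D *_) by-pairs ⟩
  D * ∑ (allFin n) (λ i → ∑ (allFin n) (λ k → 𝟙 (¬? (i Fin.≟ k)) * #sending i k i k))
    ≡⟨ *-distribˡ-∑ D (allFin n) _ ⟩
  ∑ (allFin n) (λ i → D * ∑ (allFin n) (λ k → 𝟙 (¬? (i Fin.≟ k)) * #sending i k i k))
    ≡⟨ ∑-cong (allFin n) (λ i → trans (*-distribˡ-∑ D (allFin n) _) (∑-cong (allFin n) (per-pair i))) ⟩
  ∑ (allFin n) (λ i → ∑ (allFin n) (λ k → length (Sym n) * 𝟙 (¬? (i Fin.≟ k))))
    ≡⟨ ∑-cong (allFin n) (λ i → *-distribˡ-∑ (length (Sym n)) (allFin n) _) ⟨
  ∑ (allFin n) (λ i → length (Sym n) * ∑ (allFin n) (λ k → 𝟙 (¬? (i Fin.≟ k))))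
    ≡⟨ *-distribˡ-∑ (length (Sym n)) (allFin n) _ ⟨
  length (Sym n) * D
    ≡⟨ *-comm (length (Sym n)) D ⟩
  D * length (Sym n)
    ∎)
  where
  open ≡-Reasoning
  D = #distinctPairs n
  term : Fin n → Fin n → RawMap n → ℕ
  term i k σ = 𝟙 (¬? (i Fin.≟ k)) * (𝟙 (fixed? σ i) * 𝟙 (fixed? σ k))
  by-pairs : ∑ (Sym n) F₂ ≡ ∑ (allFin n) (λ i → ∑ (allFin n) (λ k → 𝟙 (¬? (i Fin.≟ k)) * #sending i k i k))
  by-pairs = begin
    ∑ (Sym n) (λ σ → ∑ (allFin n) (λ i → ∑ (allFin n) (λ k → term i k σ)))
      ≡⟨ ∑-comm (Sym n) (allFin n) _ ⟩
    ∑ (allFin n) (λ i → ∑ (Sym n) (λ σ → ∑ (allFin n) (λ k → term i k σ)))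
      ≡⟨ ∑-cong (allFin n) (λ i → ∑-comm (Sym n) (allFin n) (λ σ k → term i k σ)) ⟩
    ∑ (allFin n) (λ i → ∑ (allFin n) (λ k → ∑ (Sym n) (term i k)))
      ≡⟨ ∑-cong (allFin n) (λ i → ∑-cong (allFin n) (λ k →
           *-distribˡ-∑ (𝟙 (¬? (i Fin.≟ k))) (Sym n) (λ σ → 𝟙 (fixed? σ i) * 𝟙 (fixed? σ k)))) ⟨
    ∑ (allFin n) (λ i → ∑ (allFin n) (λ k → 𝟙 (¬? (i Fin.≟ k)) * #sending i k i k))
      ∎
  per-pair : ∀ i k → D * (𝟙 (¬? (i Fin.≟ k)) * #sending i k i k) ≡ length (Sym n) * 𝟙 (¬? (i Fin.≟ k))
  per-pair i k with i Fin.≟ k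
  ... | yes _   = trans (*-zeroʳ D) (sym (*-zeroʳ (length (Sym n))))
  ... | no  i≢k = trans (cong (D *_) (*-identityˡ _))
                        (trans (#distinctPairs*#sending i k i≢k) (sym (*-identityʳ _)))

-- The order of S_n

-- For k = n, Distinct and distinct? are IsPerm and isPerm? verbatim.
Distinct : ∀ {n k} → Vec (Fin n) k → Set
Distinct v = ∀ i j → lookup v i ≡ lookup v j → i ≡ j

distinct? : ∀ {n k} (v : Vec (Fin n) k) → Dec (Distinct v)
distinct? v = all? (λ i → all? (λ j → (lookup v i Fin.≟ lookup v j) →-dec (i Fin.≟ j)))

Occurs : ∀ {n k} → Fin n → Vec (Fin n) k → Set
Occurs x r = ∃ λ i → lookup r i ≡ x

occurs? : ∀ {n k} (x : Fin n) (r : Vec (Fin n) k) → Dec (Occurs x r)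
occurs? x r = any? (λ i → lookup r i Fin.≟ x)

Distinct-tail : ∀ {n k} {x : Fin n} {r : Vec (Fin n) k} → Distinct (x ∷ r) → Distinct r
Distinct-tail distinct i j eq = suc-injective (distinct (suc i) (suc j) eq)

𝟙-distinct?-∷ : ∀ {n k} (x : Fin n) (r : Vec (Fin n) k) →
                𝟙 (distinct? (x ∷ r)) ≡ 𝟙 (distinct? r) * 𝟙 (¬? (occurs? x r))
𝟙-distinct?-∷ x r = trans (𝟙-cong split join (distinct? (x ∷ r)) (distinct? r ×-dec ¬? (occurs? x r)))
                          (𝟙-×-dec (distinct? r) (¬? (occurs? x r)))
  where
  split : Distinct (x ∷ r) → Distinct r × ¬ Occurs x r
  split distinct = Distinct-tail distinct , λ (i , ri≡x) → 0≢1+n (distinct zero (suc i) (sym ri≡x))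
  join : Distinct r × ¬ Occurs x r → Distinct (x ∷ r)
  join (distinct , fresh) zero    zero    _  = refl
  join (distinct , fresh) zero    (suc j) eq = ⊥-elim (fresh (j , sym eq))
  join (distinct , fresh) (suc i) zero    eq = ⊥-elim (fresh (i , eq))
  join (distinct , fresh) (suc i) (suc j) eq = cong suc (distinct i j eq)

#occurring : ∀ {n k} (r : Vec (Fin n) k) → Distinct r → ∑ (allFin n) (λ x → 𝟙 (occurs? x r)) ≡ k
#occurring {n} []      _        = trans (∑-cong (allFin n) nowhere) (∑-zero (allFin n))
  where
  nowhere : ∀ x → 𝟙 (occurs? x []) ≡ 0
  nowhere x with occurs? x []
  ... | no _ = refl
#occurring {n} (a ∷ r) distinct = begin
  ∑ (allFin n) (λ x → 𝟙 (occurs? x (a ∷ r)))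
    ≡⟨ ∑-cong (allFin n) head-or-tail ⟩
  ∑ (allFin n) (λ x → 𝟙 (a Fin.≟ x) * 1 + 𝟙 (occurs? x r))
    ≡⟨ ∑-distrib-+ (allFin n) ⟩
  ∑ (allFin n) (λ x → 𝟙 (a Fin.≟ x) * 1) + ∑ (allFin n) (λ x → 𝟙 (occurs? x r))
    ≡⟨ cong₂ _+_ (∑-allFin-δ a (λ _ → 1)) (#occurring r (Distinct-tail distinct)) ⟩
  suc _
    ∎
  where
  open ≡-Reasoning
  head-or-tail : ∀ x → 𝟙 (occurs? x (a ∷ r)) ≡ 𝟙 (a Fin.≟ x) * 1 + 𝟙 (occurs? x r)
  head-or-tail x = trans
    (𝟙-⊎ (λ { (zero , a≡x) → inj₁ a≡x ; (suc i , ri≡x) → inj₂ (i , ri≡x) })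
         [ (λ a≡x → zero , a≡x) , (λ (i , ri≡x) → suc i , ri≡x) ]′
         (λ a≡x (i , ri≡x) → 0≢1+n (distinct zero (suc i) (trans a≡x (sym ri≡x))))
         (occurs? x (a ∷ r)) (a Fin.≟ x) (occurs? x r))
    (cong (_+ 𝟙 (occurs? x r)) (sym (*-identityʳ _)))

#missing : ∀ {n k} (r : Vec (Fin n) k) → Distinct r → ∑ (allFin n) (λ x → 𝟙 (¬? (occurs? x r))) ≡ n ∸ k
#missing {n} {k} r distinct = begin
  ∑ (allFin n) missing                                         ≡⟨ m+n∸n≡m _ k ⟨
  ∑ (allFin n) missing + k ∸ k                                 ≡⟨ cong (λ o → ∑ (allFin n) missing + o ∸ k) (#occurring r distinct) ⟨
  ∑ (allFin n) missing + ∑ (allFin n) occurring ∸ k            ≡⟨ cong (_∸ k) (∑-distrib-+ (allFin n)) ⟨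
  ∑ (allFin n) (λ x → missing x + occurring x) ∸ k             ≡⟨ cong (_∸ k) (∑-cong (allFin n) (λ x → 𝟙-¬?+𝟙 (occurs? x r))) ⟩
  ∑ (allFin n) (λ _ → 1) ∸ k                                   ≡⟨ cong (_∸ k) (∑-allFin-const n 1) ⟩
  n * 1 ∸ k                                                    ≡⟨ cong (_∸ k) (*-identityʳ n) ⟩
  n ∸ k                                                        ∎
  where
  open ≡-Reasoning
  missing occurring : Fin _ → ℕ
  missing x = 𝟙 (¬? (occurs? x r))
  occurring x = 𝟙 (occurs? x r)

#distinct : ∀ {n} k → ∑ (allVecs {n} k) (𝟙 ∘ distinct?) ≡ n P′ k
#distinct {n} zero    with distinct? {n} []
... | yes _        = refl
... | no  ¬distinct = ⊥-elim (¬distinct (λ ()))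
#distinct {n} (suc k) = begin
  ∑ (allVecs {n} (suc k)) (𝟙 ∘ distinct?)
    ≡⟨ ∑-allVecs-suc {n} k (𝟙 ∘ distinct?) ⟩
  ∑ (allFin n) (λ x → ∑ (allVecs k) (λ r → 𝟙 (distinct? (x ∷ r))))
    ≡⟨ ∑-cong (allFin n) (λ x → ∑-cong (allVecs k) (𝟙-distinct?-∷ x)) ⟩
  ∑ (allFin n) (λ x → ∑ (allVecs k) (λ r → 𝟙 (distinct? r) * 𝟙 (¬? (occurs? x r))))
    ≡⟨ ∑-comm (allFin n) (allVecs k) _ ⟩
  ∑ (allVecs k) (λ r → ∑ (allFin n) (λ x → 𝟙 (distinct? r) * 𝟙 (¬? (occurs? x r))))
    ≡⟨ ∑-cong (allVecs k) extensions ⟩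
  ∑ (allVecs k) (λ r → (n ∸ k) * 𝟙 (distinct? r))
    ≡⟨ *-distribˡ-∑ (n ∸ k) (allVecs k) (𝟙 ∘ distinct?) ⟨
  (n ∸ k) * ∑ (allVecs k) (𝟙 ∘ distinct?)
    ≡⟨ cong ((n ∸ k) *_) (#distinct k) ⟩
  (n ∸ k) * (n P′ k)
    ∎
  where
  open ≡-Reasoning
  extensions : ∀ r → ∑ (allFin n) (λ x → 𝟙 (distinct? r) * 𝟙 (¬? (occurs? x r))) ≡ (n ∸ k) * 𝟙 (distinct? r)
  extensions r = by-cases (distinct? r)
    where
    by-cases : (d : Dec (Distinct r)) → ∑ (allFin n) (λ x → 𝟙 d * 𝟙 (¬? (occurs? x r))) ≡ (n ∸ k) * 𝟙 d
    by-cases (yes distinct) = trans (∑-cong (allFin n) (λ x → +-identityʳ _))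
                                    (trans (#missing r distinct) (sym (*-identityʳ (n ∸ k))))
    by-cases (no _)         = trans (∑-zero (allFin n)) (sym (*-zeroʳ (n ∸ k)))

length-Sym : ∀ n → length (Sym n) ≡ n !
length-Sym n = begin
  length (Sym n)                       ≡⟨ length-filter≡∑𝟙 isPerm? (allVecs n) ⟩
  ∑ (allVecs n) (𝟙 ∘ distinct?)        ≡⟨ #distinct n ⟩
  n P′ n                               ≡⟨ nP′n≡n! n ⟩
  n !                                  ∎
  where open ≡-Reasoning

-- Moments and designs

length-cartesianProduct : ∀ (xs : List A) (ys : List B) → length (cartesianProduct xs ys) ≡ length xs * length ys
length-cartesianProduct []       ys = refl
length-cartesianProduct (x ∷ xs) ys = trans (length-++ (map (x ,_) ys))
                                            (cong₂ _+_ (length-map (x ,_) ys) (length-cartesianProduct xs ys))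

≢[]⇒length-nonZero : ∀ (xs : List A) → xs ≢ [] → NonZero (length xs)
≢[]⇒length-nonZero []      xs≢[] = ⊥-elim (xs≢[] refl)
≢[]⇒length-nonZero (_ ∷ _) _     = _

moment : ∀ {n} → ℕ → List (RawMap n) → ℕ
moment i X = ∑ X (λ ν → moved ν ^ i)

∑F₂-via-moments : ∀ {n} (X : List (RawMap n)) →
                  ∑ X F₂ + length X * n + 2 * n * moment 1 X ≡ length X * (n * n) + moment 2 X + moment 1 X
∑F₂-via-moments {n} X = begin
  ∑ X F₂ + length X * n + 2 * n * moment 1 X
    ≡⟨ cong₂ (λ s t → ∑ X F₂ + s + t) (sym (∑-const X n)) (*-distribˡ-∑ (2 * n) X (λ ν → moved ν ^ 1)) ⟩
  ∑ X F₂ + ∑ X (λ _ → n) + ∑ X (λ ν → 2 * n * moved ν ^ 1)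
    ≡⟨ cong (_+ ∑ X (λ ν → 2 * n * moved ν ^ 1)) (∑-distrib-+ X) ⟨
  ∑ X (λ ν → F₂ ν + n) + ∑ X (λ ν → 2 * n * moved ν ^ 1)
    ≡⟨ ∑-distrib-+ X ⟨
  ∑ X (λ ν → F₂ ν + n + 2 * n * moved ν ^ 1)
    ≡⟨ ∑-cong X F₂-quadratic-in-moved ⟩
  ∑ X (λ ν → n * n + moved ν ^ 2 + moved ν ^ 1)
    ≡⟨ ∑-distrib-+ X ⟩
  ∑ X (λ ν → n * n + moved ν ^ 2) + moment 1 X
    ≡⟨ cong (_+ moment 1 X) (trans (∑-distrib-+ X) (cong (_+ moment 2 X) (∑-const X (n * n)))) ⟩
  length X * (n * n) + moment 2 X + moment 1 X
    ∎
  where open ≡-Reasoning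

cross-multiply : ∀ n s s′ a a′ p p′ q q′ →
                 a + s * n + 2 * n * p ≡ s * (n * n) + q + p →
                 a′ + s′ * n + 2 * n * p′ ≡ s′ * (n * n) + q′ + p′ →
                 s′ * p ≡ s * p′ → s′ * q ≡ s * q′ → s′ * a ≡ s * a′
cross-multiply n s s′ a a′ p p′ q q′ eq eq′ pp qq = +-cancelʳ-≡ (s * s′ * n + 2 * n * (s * p′)) _ _ (begin
  s′ * a + (s * s′ * n + 2 * n * (s * p′))  ≡⟨ cong (λ t → s′ * a + (s * s′ * n + 2 * n * t)) pp ⟨
  s′ * a + (s * s′ * n + 2 * n * (s′ * p))  ≡⟨ expand₁ s′ a s n p ⟨
  s′ * (a + s * n + 2 * n * p)              ≡⟨ cong (s′ *_) eq ⟩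
  s′ * (s * (n * n) + q + p)                ≡⟨ expand₂ s′ s n q p ⟩
  s * s′ * (n * n) + s′ * q + s′ * p        ≡⟨ cong₂ (λ u w → s * s′ * (n * n) + u + w) qq pp ⟩
  s * s′ * (n * n) + s * q′ + s * p′        ≡⟨ expand₄ s s′ n q′ p′ ⟨
  s * (s′ * (n * n) + q′ + p′)              ≡⟨ cong (s *_) eq′ ⟨
  s * (a′ + s′ * n + 2 * n * p′)            ≡⟨ expand₃ s a′ s′ n p′ ⟩
  s * a′ + (s * s′ * n + 2 * n * (s * p′))  ∎)
  where
  open ≡-Reasoning
  expand₁ : ∀ s′ a s n p → s′ * (a + s * n + 2 * n * p) ≡ s′ * a + (s * s′ * n + 2 * n * (s′ * p))
  expand₁ = solve-∀
  expand₂ : ∀ s′ s n q p → s′ * (s * (n * n) + q + p) ≡ s * s′ * (n * n) + s′ * q + s′ * p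
  expand₂ = solve-∀
  expand₃ : ∀ s a′ s′ n p′ → s * (a′ + s′ * n + 2 * n * p′) ≡ s * a′ + (s * s′ * n + 2 * n * (s * p′))
  expand₃ = solve-∀
  expand₄ : ∀ s s′ n q′ p′ → s * (s′ * (n * n) + q′ + p′) ≡ s * s′ * (n * n) + s * q′ + s * p′
  expand₄ = solve-∀

∑F₂-from-moments : ∀ {n} (X Z : List (RawMap n)) →
                   length Z * moment 1 X ≡ length X * moment 1 Z →
                   length Z * moment 2 X ≡ length X * moment 2 Z →
                   length Z * ∑ X F₂ ≡ length X * ∑ Z F₂
∑F₂-from-moments {n} X Z =
  cross-multiply n (length X) (length Z) (∑ X F₂) (∑ Z F₂) (moment 1 X) (moment 1 Z) (moment 2 X) (moment 2 Z)
                 (∑F₂-via-moments X) (∑F₂-via-moments Z)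

Σ≤-by-value : ∀ n (xs : List A) (h : A → ℕ) → (∀ x → h x ≤ n) → (g : ℕ → ℕ) →
              Σ≤ n (λ j → ∑ xs (λ x → 𝟙 (h x ℕ.≟ j)) * g j) ≡ ∑ xs (g ∘ h)
Σ≤-by-value n xs h h≤n g = begin
  ∑ (upTo (suc n)) (λ j → ∑ xs (λ x → 𝟙 (h x ℕ.≟ j)) * g j)
    ≡⟨ ∑-cong (upTo (suc n)) (λ j → trans (*-comm _ (g j)) (*-distribˡ-∑ (g j) xs _)) ⟩
  ∑ (upTo (suc n)) (λ j → ∑ xs (λ x → g j * 𝟙 (h x ℕ.≟ j)))
    ≡⟨ ∑-comm (upTo (suc n)) xs _ ⟩
  ∑ xs (λ x → ∑ (upTo (suc n)) (λ j → g j * 𝟙 (h x ℕ.≟ j)))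
    ≡⟨ ∑-cong xs (λ x → trans (∑-cong (upTo (suc n)) (λ j → *-comm (g j) _)) (∑-upTo-δ g (s≤s (h≤n x)))) ⟩
  ∑ xs (g ∘ h)
    ∎
  where open ≡-Reasoning

quotients : ∀ {n} → List (RawMap n) → List (RawMap n)
quotients Y = map (λ (x , y) → x ∘ₚ inv y) (cartesianProduct Y Y)

length-quotients : ∀ {n} (Y : List (RawMap n)) → length (quotients Y) ≡ length Y ^ 2
length-quotients Y = trans (length-map _ (cartesianProduct Y Y))
                           (trans (length-cartesianProduct Y Y) (cong (length Y *_) (sym (*-identityʳ _))))

Σ≤-pairCount : ∀ {n} (Y : List (RawMap n)) i → Σ≤ n (λ j → pairCount Y j * j ^ i) ≡ moment i (quotients Y)
Σ≤-pairCount {n} Y i = begin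
  Σ≤ n (λ j → pairCount Y j * j ^ i)
    ≡⟨ ∑-cong (upTo (suc n)) (λ j → cong (_* j ^ i) (length-filter≡∑𝟙 _ (cartesianProduct Y Y))) ⟩
  Σ≤ n (λ j → ∑ (cartesianProduct Y Y) (λ (x , y) → 𝟙 (dS x y ℕ.≟ j)) * j ^ i)
    ≡⟨ Σ≤-by-value n (cartesianProduct Y Y) (λ (x , y) → dS x y) (λ (x , y) → m∸n≤m n (F (x ∘ₚ inv y))) (_^ i) ⟩
  ∑ (cartesianProduct Y Y) (λ (x , y) → dS x y ^ i)
    ≡⟨ ∑-map _ (cartesianProduct Y Y) (λ ν → moved ν ^ i) ⟨
  moment i (quotients Y)
    ∎
  where open ≡-Reasoning

Σ≤-v : ∀ n i → Σ≤ n (λ j → v n j * j ^ i) ≡ moment i (Sym n)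
Σ≤-v n i = begin
  Σ≤ n (λ j → v n j * j ^ i)
    ≡⟨ ∑-cong-∈ (upTo (suc n)) (λ j∈ → cong (_* _) (count-moved (ℕ.s≤s⁻¹ (∈-upTo⁻ j∈)))) ⟩
  Σ≤ n (λ j → ∑ (Sym n) (λ σ → 𝟙 (moved σ ℕ.≟ j)) * j ^ i)
    ≡⟨ Σ≤-by-value n (Sym n) moved (λ σ → m∸n≤m n (F σ)) (_^ i) ⟩
  moment i (Sym n)
    ∎
  where
  open ≡-Reasoning
  count-moved : ∀ {j} → j ≤ n → v n j ≡ ∑ (Sym n) (λ σ → 𝟙 (moved σ ℕ.≟ j))
  count-moved {j} j≤n = trans (length-filter≡∑𝟙 _ (Sym n)) (∑-cong (Sym n) λ σ →
    𝟙-cong (λ F≡n∸j → trans (cong (n ∸_) F≡n∸j) (m∸[m∸n]≡n j≤n))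
           (λ moved≡j → trans (sym (m∸[m∸n]≡n (F≤n σ))) (cong (n ∸_) moved≡j))
           (F σ ℕ.≟ n ∸ j) (moved σ ℕ.≟ j))

design⇒∑F₂-quotients : ∀ {n} → 2 ≤ n → (Y : List (RawMap n)) → IsDesign n 2 Y → ∑ (quotients Y) F₂ ≡ length Y ^ 2
design⇒∑F₂-quotients {n} 2≤n Y design = *-cancelˡ-≡ _ _ (n !) {{n !≢0}} (begin
  n ! * ∑ (quotients Y) F₂                ≡⟨ cong (_* ∑ (quotients Y) F₂) (length-Sym n) ⟨
  length (Sym n) * ∑ (quotients Y) F₂     ≡⟨ ∑F₂-from-moments (quotients Y) (Sym n) (moments-agree 1 ≤-refl (s≤s z≤n))
                                                                                 (moments-agree 2 (s≤s z≤n) ≤-refl) ⟩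
  length (quotients Y) * ∑ (Sym n) F₂     ≡⟨ cong₂ _*_ (length-quotients Y) (trans (∑-Sym-F₂ n 2≤n) (length-Sym n)) ⟩
  length Y ^ 2 * n !                      ≡⟨ *-comm (length Y ^ 2) (n !) ⟩
  n ! * length Y ^ 2                      ∎)
  where
  open ≡-Reasoning
  moments-agree : ∀ i → 1 ≤ i → i ≤ 2 →
                  length (Sym n) * moment i (quotients Y) ≡ length (quotients Y) * moment i (Sym n)
  moments-agree i 1≤i i≤2 = begin
    length (Sym n) * moment i (quotients Y)
      ≡⟨ cong₂ _*_ (length-Sym n) (sym (Σ≤-pairCount Y i)) ⟩
    n ! * Σ≤ n (λ j → pairCount Y j * j ^ i)
      ≡⟨ design i 1≤i i≤2 ⟩
    length Y ^ 2 * Σ≤ n (λ j → v n j * j ^ i)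
      ≡⟨ cong₂ _*_ (sym (length-quotients Y)) (Σ≤-v n i) ⟩
    length (quotients Y) * moment i (Sym n)
      ∎

∑F₂-quotients-lower-bound : ∀ {n} (Y : List (RawMap n)) → All IsPerm Y →
                            length Y * (n * n ∸ n) ≤ ∑ (quotients Y) F₂
∑F₂-quotients-lower-bound {n} Y perms = begin
  length Y * (n * n ∸ n)                          ≡⟨ ∑-const Y (n * n ∸ n) ⟨
  ∑ Y (λ _ → n * n ∸ n)                           ≤⟨ ∑-mono-≤ Y diagonal ⟩
  ∑ Y (λ x → ∑ Y (λ y → F₂ (x ∘ₚ inv y)))         ≡⟨ ∑-cartesianProduct Y Y (λ (x , y) → F₂ (x ∘ₚ inv y)) ⟨
  ∑ (cartesianProduct Y Y) (λ (x , y) → F₂ (x ∘ₚ inv y)) ≡⟨ ∑-map _ (cartesianProduct Y Y) F₂ ⟨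
  ∑ (quotients Y) F₂                              ∎
  where
  open ≤-Reasoning
  diagonal : ∀ {x} → x ∈ Y → n * n ∸ n ≤ ∑ Y (λ y → F₂ (x ∘ₚ inv y))
  diagonal {x} x∈Y = ≤-trans
    (≤-reflexive (trans (sym (cong (_∸ n) (F₂-∘ₚ-inv x (All.lookup perms x∈Y)))) (m+n∸n≡m _ n)))
    (∈⇒≤∑ (λ y → F₂ (x ∘ₚ inv y)) x∈Y)

[n∸1]²+1≤n²∸n : ∀ n → 2 ≤ n → (n ∸ 1) ^ 2 + 1 ≤ n * n ∸ n
[n∸1]²+1≤n²∸n (suc zero)    (s≤s ())
[n∸1]²+1≤n²∸n (suc (suc k)) _ = ≤-trans (m≤m+n _ k) (≤-reflexive (sym (begin
  suc (suc k) * suc (suc k) ∸ suc (suc k)                          ≡⟨ cong (_∸ suc (suc k)) (square-split k) ⟩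
  suc k * (suc k * 1) + 1 + k + suc (suc k) ∸ suc (suc k)          ≡⟨ m+n∸n≡m _ (suc (suc k)) ⟩
  suc k * (suc k * 1) + 1 + k                                      ∎)))
  where
  open ≡-Reasoning
  square-split : ∀ k → suc (suc k) * suc (suc k) ≡ suc k * (suc k * 1) + 1 + k + suc (suc k)
  square-split = solve-∀

corollary2 : ∀ (n : ℕ) → 2 ≤ n → (Y : List (RawMap n)) →
    All IsPerm Y → Unique Y → Y ≢ [] → IsDesign n 2 Y →
    (n ∸ 1) ^ 2 + 1 ≤ length Y
corollary2 n 2≤n Y perms _ Y≢[] design =
  ≤-trans ([n∸1]²+1≤n²∸n n 2≤n) (*-cancelˡ-≤ (length Y) {{≢[]⇒length-nonZero Y Y≢[]}} (begin
  length Y * (n * n ∸ n)      ≤⟨ ∑F₂-quotients-lower-bound Y perms ⟩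
  ∑ (quotients Y) F₂          ≡⟨ design⇒∑F₂-quotients 2≤n Y design ⟩
  length Y * (length Y * 1)   ≡⟨ cong (length Y *_) (*-identityʳ (length Y)) ⟩
  length Y * length Y         ∎))
  where open ≤-Reasoning
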